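{- Let $H$ be any minimal solution to $k$-DST. Then, for any vertex $v\in V(H)$, $H$ has at most $k$ edge-disjoint directed $r,v$-paths.
   Context: An instance of $k$-DST consists of a directed graph $G$ with edge costs, a root vertex $r$, a set of terminals $T\subseteq V(G)$ and an integer $k\ge1$. A feasible solution is a subgraph $H\subseteq G$ that contains $k$ pairwise edge-disjoint directed $r,t$-paths for every $t\in T$. A minimal solution is a feasible solution $H$ such that for every edge $e\in E(H)$, the graph $H\setminus e$ is not feasible. -}

module Defs where

open import Data.Nat using (ℕ; suc)
open import Data.Fin using (Fin; _≟_)
open import Data.Fin.Subset using (Subset; _∈_; _-_)
open import Data.List using (List; []; _∷_; map)
open import Data.List.Relation.Unary.Unique.Propositional using (Unique)
import Data.List.Membership.Propositional as LM
open import Data.Product using (Σ; ∃; _×_; _,_)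
open import Data.Sum using (_⊎_)
open import Function.Definitions using (Injective)
open import Relation.Binary.PropositionalEquality using (_≡_)
open import Relation.Nullary using (¬_)

-- A finite directed multigraph with n vertices and m edges; edge e goes
-- from tail e to head e and has a cost (costs play no role for feasibility
-- or minimality).
record Digraph : Set where
  field
    n    : ℕ
    m    : ℕ
    tail : Fin m → Fin n
    head : Fin m → Fin n
    cost : Fin m → ℕ
open Digraph public

Vertex : Digraph → Set
Vertex G = Fin (n G)

Edge : Digraph → Set
Edge G = Fin (m G)

-- A subgraph is given by its edge set.
EdgeSet : Digraph → Set
EdgeSet G = Subset (m G)

data Walk (G : Digraph) (H : EdgeSet G) : Vertex G → Vertex G → List (Edge G) → Set where
  []  : ∀ {u} → Walk G H u u []
  _∷_ : ∀ {u w es} (e : Edge G) → {tail G e ≡ u} → {e ∈ H} →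
        Walk G H (head G e) w es → Walk G H u w (e ∷ es)

walkVertices : (G : Digraph) → Vertex G → List (Edge G) → List (Vertex G)
walkVertices G u es = u ∷ map (head G) es

IsPath : (G : Digraph) (H : EdgeSet G) → Vertex G → Vertex G → List (Edge G) → Set
IsPath G H u w es = Walk G H u w es × Unique (walkVertices G u es)

HasDisjointPaths : (G : Digraph) (H : EdgeSet G) → Vertex G → Vertex G → ℕ → Set
HasDisjointPaths G H u w j =
  Σ (Fin j → List (Edge G)) λ P →
    ((i : Fin j) → IsPath G H u w (P i)) ×
    Injective _≡_ _≡_ P ×
    (∀ i i' → ¬ i ≡ i' → ∀ e → e LM.∈ P i → e LM.∈ P i' → Data.Empty.⊥)
  where import Data.Empty

Feasible : (G : Digraph) (r : Vertex G) (T : Subset (n G)) (k : ℕ) → EdgeSet G → Set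
Feasible G r T k H = ∀ t → t ∈ T → HasDisjointPaths G H r t k

Minimal : (G : Digraph) (r : Vertex G) (T : Subset (n G)) (k : ℕ) → EdgeSet G → Set
Minimal G r T k H =
  Feasible G r T k H × (∀ e → e ∈ H → ¬ Feasible G r T k (H - e))

InV : (G : Digraph) → EdgeSet G → Vertex G → Subset (n G) → Vertex G → Set
InV G H r T v =
  v ≡ r ⊎ v ∈ T ⊎ ∃ λ e → e ∈ H × (tail G e ≡ v ⊎ head G e ≡ v)

module Submission where

-- Idea.  v ≠ r, since distinct r,r-paths do not exist.  Let e₀ be an edge of H
-- entering v.  We show that H - e₀ is still feasible, contradicting minimality.
-- If some terminal t had fewer than k edge-disjoint r,t-paths in H - e₀, Menger's
-- theorem would give a set X ∋ r, ∌ t left by fewer than k edges of H - e₀.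
-- If v ∈ X, then e₀ does not leave X, so X is a cut of H with fewer than k edges,
-- although H has k edge-disjoint r,t-paths.  If v ∉ X, at most k edges of H leave X,
-- yet each of the k + 1 disjoint r,v-paths must use one of them.

open import Defs

open import Data.Nat using (ℕ; zero; suc; _+_; _≤_; _<_; _≥_; z≤n; s≤s)
open import Data.Nat.Properties
open import Data.Nat.Tactic.RingSolver using (solve-∀)
open import Data.Bool using (Bool; true; false; _∧_; _∨_; not; if_then_else_)
open import Data.Bool.Properties using (∧-assoc; ∧-comm; ∨-zeroʳ; if-eta)
open import Data.Fin using (Fin; zero; suc) renaming (_≟_ to _≟F_)
open import Data.List using (List; []; _∷_; map; length; allFin; _++_)
open import Data.Bool.ListAction using (any)
open import Data.List.Properties using (length-map; length-tabulate)
open import Data.List.Relation.Unary.Unique.Propositional using (Unique)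
open import Data.List.Relation.Unary.Unique.Propositional.Properties using (map⁺; allFin⁺)
open import Data.List.Relation.Unary.AllPairs using ([]; _∷_)
open import Data.List.Relation.Unary.All using (All; []; _∷_)
open import Data.List.Relation.Unary.All.Properties using (¬Any⇒All¬; All¬⇒¬Any)
open import Data.List.Relation.Unary.Any using (here; there)
open import Data.List.Membership.Propositional using (_∈_)
open import Data.List.Membership.Propositional.Properties using (∈-allFin; ∈-map⁻; ∈-map⁺; ∈-++⁺ˡ; ∈-++⁺ʳ)
open import Data.Product using (Σ; _×_; _,_; proj₁; proj₂)
open import Data.Sum using (_⊎_; inj₁; inj₂)
open import Data.Empty using (⊥; ⊥-elim)
open import Relation.Nullary using (¬_; does; yes; no)
open import Relation.Nullary.Decidable using (dec-true; dec-false)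
open import Relation.Binary.PropositionalEquality
open import Data.Fin.Subset using (Subset; _-_) renaming (_∈_ to _∈ₛ_)
open import Data.Fin.Subset.Properties using (x∈p∧x≢y⇒x∈p-y)
open import Data.Vec using (lookup)
open import Data.Vec.Properties using ([]=⇒lookup; lookup⇒[]=)

true≢false : ¬ true ≡ false
true≢false ()

𝟙 : Bool → ℕ
𝟙 b = if b then 1 else 0

sumOver : {A : Set} → (A → ℕ) → List A → ℕ
sumOver f []       = 0
sumOver f (x ∷ xs) = f x + sumOver f xs

sumOver-cong : ∀ {A : Set} {f g : A → ℕ} xs → (∀ x → f x ≡ g x) → sumOver f xs ≡ sumOver g xs
sumOver-cong []       f≗g = refl
sumOver-cong (x ∷ xs) f≗g = cong₂ _+_ (f≗g x) (sumOver-cong xs f≗g)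

sumOver-congAll : ∀ {A : Set} {f g : A → ℕ} {xs} → All (λ x → f x ≡ g x) xs → sumOver f xs ≡ sumOver g xs
sumOver-congAll []       = refl
sumOver-congAll (p ∷ ps) = cong₂ _+_ p (sumOver-congAll ps)

sumOver-mono : ∀ {A : Set} {f g : A → ℕ} xs → (∀ x → f x ≤ g x) → sumOver f xs ≤ sumOver g xs
sumOver-mono []       f≤g = z≤n
sumOver-mono (x ∷ xs) f≤g = +-mono-≤ (f≤g x) (sumOver-mono xs f≤g)

sumOver-+ : ∀ {A : Set} (f g : A → ℕ) xs → sumOver (λ x → f x + g x) xs ≡ sumOver f xs + sumOver g xs
sumOver-+ f g []       = refl
sumOver-+ f g (x ∷ xs) rewrite sumOver-+ f g xs = interchange (f x) (g x) (sumOver f xs) (sumOver g xs)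
  where
  interchange : ∀ a b c d → a + b + (c + d) ≡ a + c + (b + d)
  interchange = solve-∀

sumOver-0 : ∀ {A : Set} (xs : List A) → sumOver (λ _ → 0) xs ≡ 0
sumOver-0 []       = refl
sumOver-0 (x ∷ xs) = sumOver-0 xs

sumOver-1 : ∀ {A : Set} (xs : List A) → sumOver (λ _ → 1) xs ≡ length xs
sumOver-1 []       = refl
sumOver-1 (x ∷ xs) = cong suc (sumOver-1 xs)

sumOver-swap : ∀ {A B : Set} (g : A → B → ℕ) xs ys →
  sumOver (λ x → sumOver (g x) ys) xs ≡ sumOver (λ y → sumOver (λ x → g x y) xs) ys
sumOver-swap g []       ys = sym (sumOver-0 ys)
sumOver-swap g (x ∷ xs) ys = trans (cong (sumOver (g x) ys +_) (sumOver-swap g xs ys))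
  (sym (sumOver-+ (g x) (λ y → sumOver (λ x → g x y) xs) ys))

sumOver-if : ∀ {A : Set} b (f : A → ℕ) xs →
  (if b then sumOver f xs else 0) ≡ sumOver (λ x → if b then f x else 0) xs
sumOver-if true  f xs = refl
sumOver-if false f xs = sym (sumOver-0 xs)

_==_ : ∀ {k} → Fin k → Fin k → Bool
a == b = does (a ≟F b)

==-refl : ∀ {k} (a : Fin k) → (a == a) ≡ true
==-refl a = dec-true (a ≟F a) refl

==-false : ∀ {k} {a b : Fin k} → ¬ a ≡ b → (a == b) ≡ false
==-false {a = a} {b} = dec-false (a ≟F b)

==-sound : ∀ {k} {a b : Fin k} → (a == b) ≡ true → a ≡ b
==-sound {a = a} {b} h with a ≟F b
... | yes a≡b = a≡b

sum-point-absent : ∀ {k} (a : Fin k) (c : Fin k → ℕ) xs → All (λ x → ¬ a ≡ x) xs →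
  sumOver (λ x → if a == x then c x else 0) xs ≡ 0
sum-point-absent a c []       []           = refl
sum-point-absent a c (x ∷ xs) (a≢x ∷ a∉xs) rewrite ==-false a≢x = sum-point-absent a c xs a∉xs

sum-point : ∀ {k} (a : Fin k) (c : Fin k → ℕ) xs → Unique xs → a ∈ xs →
  sumOver (λ x → if a == x then c x else 0) xs ≡ c a
sum-point a c (x ∷ xs) (a∉xs ∷ u) (here refl)
  rewrite ==-refl a | sum-point-absent a c xs a∉xs = +-identityʳ (c a)
sum-point a c (x ∷ xs) (x∉xs ∷ u) (there a∈xs) with a ≟F x
... | yes refl = ⊥-elim (All¬⇒¬Any x∉xs a∈xs)
... | no _     = sum-point a c xs u a∈xs

sum-point-allFin : ∀ {k} (a : Fin k) (c : Fin k → ℕ) →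
  sumOver (λ x → if a == x then c x else 0) (allFin k) ≡ c a
sum-point-allFin {k} a c = sum-point a c (allFin k) (allFin⁺ k) (∈-allFin a)

sum-change : ∀ {k} (a : Fin k) (f g : Fin k → ℕ) xs → Unique xs → a ∈ xs →
  (∀ x → ¬ x ≡ a → f x ≡ g x) → sumOver f xs + g a ≡ sumOver g xs + f a
sum-change a f g (x ∷ xs) (a∉xs ∷ u) (here refl) f≗g = begin
    f a + sumOver f xs + g a  ≡⟨ cong (λ s → f a + s + g a) (sumOver-congAll (agree a∉xs)) ⟩
    f a + sumOver g xs + g a  ≡⟨ shuffle (f a) (g a) (sumOver g xs) ⟩
    g a + sumOver g xs + f a  ∎
  where
  open ≡-Reasoning
  agree : ∀ {ys} → All (λ y → ¬ a ≡ y) ys → All (λ y → f y ≡ g y) ys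
  agree []         = []
  agree (a≢y ∷ ps) = f≗g _ (λ y≡a → a≢y (sym y≡a)) ∷ agree ps
  shuffle : ∀ p q s → p + s + q ≡ q + s + p
  shuffle = solve-∀
sum-change a f g (x ∷ xs) (x∉xs ∷ u) (there a∈xs) f≗g with x ≟F a
... | yes refl = ⊥-elim (All¬⇒¬Any x∉xs a∈xs)
... | no x≢a rewrite f≗g x x≢a | +-assoc (g x) (sumOver f xs) (g a) | sum-change a f g xs u a∈xs f≗g =
  sym (+-assoc (g x) (sumOver g xs) (f a))

sum-change-allFin : ∀ {k} (a : Fin k) (f g : Fin k → ℕ) →
  (∀ x → ¬ x ≡ a → f x ≡ g x) → sumOver f (allFin k) + g a ≡ sumOver g (allFin k) + f a
sum-change-allFin {k} a f g = sum-change a f g (allFin k) (allFin⁺ k) (∈-allFin a)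

count : ∀ {k} → (Fin k → Bool) → ℕ
count {k} p = sumOver (λ x → 𝟙 (p x)) (allFin k)

count-cong : ∀ {k} {p q : Fin k → Bool} → (∀ x → p x ≡ q x) → count p ≡ count q
count-cong {k} p≗q = sumOver-cong (allFin k) (λ x → cong 𝟙 (p≗q x))

𝟙-mono : ∀ {a b} → (a ≡ true → b ≡ true) → 𝟙 a ≤ 𝟙 b
𝟙-mono {false} a⇒b = z≤n
𝟙-mono {true}  a⇒b rewrite a⇒b refl = ≤-refl

count-mono : ∀ {k} {p q : Fin k → Bool} → (∀ x → p x ≡ true → q x ≡ true) → count p ≤ count q
count-mono {k} p⇒q = sumOver-mono (allFin k) (λ x → 𝟙-mono (p⇒q x))

count-split : ∀ {k} (p q : Fin k → Bool) → count p ≡ count (λ x → p x ∧ q x) + count (λ x → p x ∧ not (q x))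
count-split {k} p q = trans (sumOver-cong (allFin k) split) (sumOver-+ _ _ (allFin k))
  where
  split : ∀ x → 𝟙 (p x) ≡ 𝟙 (p x ∧ q x) + 𝟙 (p x ∧ not (q x))
  split x with p x | q x
  ... | false | _     = refl
  ... | true  | true  = refl
  ... | true  | false = refl

count-zero : ∀ {k} (p : Fin k → Bool) → (∀ x → p x ≡ false) → count p ≡ 0
count-zero {k} p p≡false = trans (sumOver-cong (allFin k) (λ x → cong 𝟙 (p≡false x))) (sumOver-0 (allFin k))

count-except-one : ∀ {k} (a : Fin k) {p q : Fin k → Bool} →
  (∀ x → ¬ x ≡ a → p x ≡ true → q x ≡ true) → count p ≤ count q + 1
count-except-one {k} a {p} {q} p⇒q = begin
    count p
  ≤⟨ sumOver-mono (allFin k) bound ⟩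
    sumOver (λ x → 𝟙 (q x) + (if a == x then 1 else 0)) (allFin k)
  ≡⟨ sumOver-+ _ _ (allFin k) ⟩
    count q + sumOver (λ x → if a == x then 1 else 0) (allFin k)
  ≡⟨ cong (count q +_) (sum-point-allFin a (λ _ → 1)) ⟩
    count q + 1 ∎
  where
  open ≤-Reasoning
  bound : ∀ x → 𝟙 (p x) ≤ 𝟙 (q x) + (if a == x then 1 else 0)
  bound x with a ≟F x
  ... | yes refl = ≤-trans (𝟙-mono {p x} {true} (λ _ → refl)) (m≤n+m 1 (𝟙 (q x)))
  ... | no a≢x   = ≤-trans (𝟙-mono (p⇒q x (λ x≡a → a≢x (sym x≡a)))) (≤-reflexive (sym (+-identityʳ _)))

unique-≤-count : ∀ {k} (xs ys : List (Fin k)) (p : Fin k → Bool) → Unique xs →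
  (∀ x → x ∈ xs → p x ≡ true) → (∀ x → x ∈ xs → x ∈ ys) →
  length xs ≤ sumOver (λ y → 𝟙 (p y)) ys
unique-≤-count []       ys p u px xs⊆ys = z≤n
unique-≤-count (x ∷ xs) ys p (x∉xs ∷ u) px xs⊆ys =
  ≤-trans (s≤s (unique-≤-count xs ys p' u p'xs (λ z z∈xs → xs⊆ys z (there z∈xs))))
          (remove-one ys (xs⊆ys x (here refl)))
  where
  p' : Fin _ → Bool
  p' y = p y ∧ not (x == y)
  p'xs : ∀ z → z ∈ xs → p' z ≡ true
  p'xs z z∈xs rewrite px z (there z∈xs) | ==-false (λ x≡z → All¬⇒¬Any x∉xs (subst (_∈ xs) (sym x≡z) z∈xs)) = refl
  p'⇒p : ∀ z → p' z ≡ true → p z ≡ true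
  p'⇒p z h with p z
  ... | true  = refl
  ... | false = h
  remove-one : ∀ zs → x ∈ zs → suc (sumOver (λ y → 𝟙 (p' y)) zs) ≤ sumOver (λ y → 𝟙 (p y)) zs
  remove-one (z ∷ zs) (here refl) rewrite px x (here refl) | ==-refl x =
    s≤s (sumOver-mono zs (λ y → 𝟙-mono (p'⇒p y)))
  remove-one (z ∷ zs) (there x∈zs) = begin
      suc (𝟙 (p' z) + sumOver (λ y → 𝟙 (p' y)) zs)
    ≡⟨ sym (+-suc _ _) ⟩
      𝟙 (p' z) + suc (sumOver (λ y → 𝟙 (p' y)) zs)
    ≤⟨ +-mono-≤ (𝟙-mono (p'⇒p z)) (remove-one zs x∈zs) ⟩
      𝟙 (p z) + sumOver (λ y → 𝟙 (p y)) zs ∎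
    where open ≤-Reasoning

unique-length-≤ : ∀ {k} (xs : List (Fin k)) → Unique xs → length xs ≤ k
unique-length-≤ {k} xs u = begin
    length xs
  ≤⟨ unique-≤-count xs (allFin k) (λ _ → true) u (λ _ _ → refl) (λ x _ → ∈-allFin x) ⟩
    sumOver (λ _ → 1) (allFin k)
  ≡⟨ sumOver-1 (allFin k) ⟩
    length (allFin k)
  ≡⟨ length-tabulate {n = k} (λ x → x) ⟩
    k ∎
  where open ≤-Reasoning

injection-≤-count : ∀ {j k} (g : Fin j → Fin k) → (∀ {a b} → g a ≡ g b → a ≡ b) →
  (p : Fin k → Bool) → (∀ i → p (g i) ≡ true) → j ≤ count p
injection-≤-count {j} {k} g g-inj p pg = begin
    j
  ≡⟨ sym (length-tabulate {n = j} (λ x → x)) ⟩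
    length (allFin j)
  ≡⟨ sym (length-map g (allFin j)) ⟩
    length (map g (allFin j))
  ≤⟨ unique-≤-count (map g (allFin j)) (allFin k) p (map⁺ g-inj (allFin⁺ j)) p-image (λ x _ → ∈-allFin x) ⟩
    count p ∎
  where
  open ≤-Reasoning
  p-image : ∀ x → x ∈ map g (allFin j) → p x ≡ true
  p-image x x∈img with ∈-map⁻ g x∈img
  ... | i , _ , refl = pg i

-- Both flows (labels
-- are edges) and residual graphs (labels are edges with an orientation) are
-- instances, so walks, shortcutting and reachability are developed once here.
module Routes {N : ℕ} {L : Set} (src dst : L → Fin N) (admissible : L → Bool) where

  data Route : Fin N → Fin N → List L → Set where
    []   : ∀ {u} → Route u u []
    step : ∀ {u w ls} (l : L) → src l ≡ u → admissible l ≡ true → Route (dst l) w ls → Route u w (l ∷ ls)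

  vertices : Fin N → List L → List (Fin N)
  vertices u ls = u ∷ map dst ls

  Simple : Fin N → List L → Set
  Simple u ls = Unique (vertices u ls)

  _⊆_ : List L → List L → Set
  xs ⊆ ys = ∀ {l} → l ∈ xs → l ∈ ys

  _++ᴿ_ : ∀ {u v w ls ls'} → Route u v ls → Route v w ls' → Route u w (ls ++ ls')
  []             ++ᴿ q = q
  step l s a p   ++ᴿ q = step l s a (p ++ᴿ q)

  suffix-from : ∀ {u w ls x} → Route u w ls → Simple u ls → x ∈ vertices u ls →
    Σ (List L) λ ls' → Route x w ls' × Simple x ls' × ls' ⊆ ls
  suffix-from {ls = ls} p s (here refl) = ls , p , s , (λ l∈ → l∈)
  suffix-from (step l _ _ p) (_ ∷ s) (there x∈) with suffix-from p s x∈
  ... | ls' , p' , s' , ls'⊆ = ls' , p' , s' , (λ l∈ → there (ls'⊆ l∈))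

  shortcut : ∀ {u w ls} → Route u w ls → Σ (List L) λ ls' → Route u w ls' × Simple u ls' × ls' ⊆ ls
  shortcut []                                 = [] , [] , [] ∷ [] , (λ ())
  shortcut {u} {w} (step {ls = ls} l s a p) = prepend (shortcut p)
    where
    open import Data.List.Membership.DecPropositional (_≟F_ {N}) using (_∈?_)
    prepend : (Σ (List L) λ ls' → Route (dst l) w ls' × Simple (dst l) ls' × ls' ⊆ ls) →
              Σ (List L) λ ls' → Route u w ls' × Simple u ls' × ls' ⊆ (l ∷ ls)
    prepend (ls' , p' , s' , ls'⊆) with u ∈? vertices (dst l) ls'
    ... | yes u∈ = let (ls'' , p'' , s'' , ls''⊆) = suffix-from p' s' u∈
                   in ls'' , p'' , s'' , (λ l∈ → there (ls'⊆ (ls''⊆ l∈)))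
    ... | no u∉  = l ∷ ls' , step l s a p' , ¬Any⇒All¬ _ u∉ ∷ s' , grow
      where
      grow : (l ∷ ls') ⊆ (l ∷ ls)
      grow (here e)  = here e
      grow (there m) = there (ls'⊆ m)

  ends-visited : ∀ {u w ls l} → Route u w ls → l ∈ ls → src l ∈ vertices u ls × dst l ∈ map dst ls
  ends-visited (step l refl _ p) (here refl) = here refl , here refl
  ends-visited (step l _ _ p)    (there l∈)  with ends-visited p l∈
  ... | src∈ , dst∈ = there src∈ , there dst∈

  avoided-not-end : ∀ {a u w ls l} → Route u w ls → All (λ y → ¬ a ≡ y) (vertices u ls) → l ∈ ls →
    ¬ src l ≡ a × ¬ dst l ≡ a
  avoided-not-end p a∉ l∈ with ends-visited p l∈
  ... | src∈ , dst∈ = (λ e → All¬⇒¬Any a∉ (subst (_∈ _) e src∈))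
                    , (λ e → All¬⇒¬Any a∉ (there (subst (_∈ _) e dst∈)))

  admissible-on-route : ∀ {u w ls l} → Route u w ls → l ∈ ls → admissible l ≡ true
  admissible-on-route (step l _ a p) (here refl) = a
  admissible-on-route (step l _ _ p) (there l∈) = admissible-on-route p l∈

  simple-length-≤ : ∀ {u w ls} → Route u w ls → Simple u ls → length ls ≤ N
  simple-length-≤ {u} {w} {ls} p s = begin
      length ls              ≤⟨ n≤1+n _ ⟩
      suc (length ls)        ≡⟨ cong suc (sym (length-map dst ls)) ⟩
      length (vertices u ls) ≤⟨ unique-length-≤ (vertices u ls) s ⟩
      N                      ∎
    where open ≤-Reasoning

  module Reachability (labels : List L) (all-labels : ∀ l → l ∈ labels) where
    reachable-within : ℕ → Fin N → Fin N → Bool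
    reachable-within zero    u x = u == x
    reachable-within (suc k) u x =
      (u == x) ∨ any (λ l → admissible l ∧ (src l == u) ∧ reachable-within k (dst l) x) labels

    any-intro : ∀ (p : L → Bool) {l} ls → l ∈ ls → p l ≡ true → any p ls ≡ true
    any-intro p (l ∷ ls) (here refl) pl rewrite pl = refl
    any-intro p (l ∷ ls) (there l∈)  pl rewrite any-intro p ls l∈ pl = ∨-zeroʳ (p l)

    any-elim : ∀ (p : L → Bool) ls → any p ls ≡ true → Σ L λ l → p l ≡ true
    any-elim p (l ∷ ls) h with p l in pl
    ... | true  = l , pl
    ... | false = any-elim p ls h

    ∧-elim : ∀ {a b} → (a ∧ b) ≡ true → a ≡ true × b ≡ true
    ∧-elim {true} h = refl , h

    reachable-sound : ∀ k u x → reachable-within k u x ≡ true → Σ (List L) λ ls → Route u x ls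
    reachable-sound zero    u x h = [] , subst (λ z → Route u z []) (==-sound h) []
    reachable-sound (suc k) u x h with u == x in u≟x
    ... | true = [] , subst (λ z → Route u z []) (==-sound u≟x) []
    ... | false with any-elim _ labels h
    ... | l , pl with ∧-elim pl
    ... | adm , pl' with ∧-elim pl'
    ... | src≡ , reach with reachable-sound k (dst l) x reach
    ... | ls , p = l ∷ ls , step l (==-sound src≡) adm p

    reachable-complete : ∀ k {u x ls} → Route u x ls → length ls ≤ k → reachable-within k u x ≡ true
    reachable-complete zero    {u} [] _ = ==-refl u
    reachable-complete (suc k) {u} [] _ rewrite ==-refl u = refl
    reachable-complete (suc k) {u} {x} (step l refl adm p) (s≤s len≤) =
      trans (cong ((u == x) ∨_) (any-intro first-step-from-u labels (all-labels l) first-step)) (∨-zeroʳ (u == x))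
      where
      first-step-from-u : L → Bool
      first-step-from-u l' = admissible l' ∧ (src l' == u) ∧ reachable-within k (dst l') x
      first-step : admissible l ∧ (src l == src l) ∧ reachable-within k (dst l) x ≡ true
      first-step rewrite adm | ==-refl (src l) = reachable-complete k p len≤

    route-or-closed-set : ∀ u w → (Σ (List L) λ ls → Route u w ls) ⊎
      (Σ (Fin N → Bool) λ X → X u ≡ true × X w ≡ false ×
        (∀ l → admissible l ≡ true → X (src l) ≡ true → X (dst l) ≡ true))
    route-or-closed-set u w with reachable-within N u w in reach
    ... | true  = inj₁ (reachable-sound N u w reach)
    ... | false = inj₂ (reachable-within N u , reachable-complete N [] z≤n , reach , closed)
      where
      closed : ∀ l → admissible l ≡ true → reachable-within N u (src l) ≡ true → reachable-within N u (dst l) ≡ true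
      closed l adm h with reachable-sound N u (src l) h
      ... | ls , p with shortcut (p ++ᴿ step l refl adm [])
      ... | ls' , p' , s' , _ = reachable-complete N p' (simple-length-≤ p' s')

weaken-route : ∀ {N} {L : Set} {src dst : L → Fin N} {adm adm' : L → Bool} {u w ls} →
  (∀ l → l ∈ ls → adm l ≡ true → adm' l ≡ true) →
  Routes.Route src dst adm u w ls → Routes.Route src dst adm' u w ls
weaken-route h Routes.[]              = Routes.[]
weaken-route h (Routes.step l s a p) = Routes.step l s (h l (here refl) a) (weaken-route (λ l' l'∈ → h l' (there l'∈)) p)

-- A set of edges is given
-- by its characteristic function E → Bool; a unit-capacity integral flow is such
-- a set, each of its edges carrying one unit.
module Flows (G : Digraph) where

  V : Set
  V = Vertex G

  E : Set
  E = Edge G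

  degree : (E → V) → (E → Bool) → V → ℕ
  degree f F x = count (λ e → F e ∧ (f e == x))

  outdeg indeg : (E → Bool) → V → ℕ
  outdeg = degree (tail G)
  indeg  = degree (head G)

  set : (E → Bool) → E → Bool → E → Bool
  set F e b e' = if e == e' then b else F e'

  set-same : ∀ F e b → set F e b e ≡ b
  set-same F e b rewrite ==-refl e = refl

  set-other : ∀ F {e e'} b → ¬ e ≡ e' → set F e b e' ≡ F e'
  set-other F b e≢e' rewrite ==-false e≢e' = refl

  degree-set : ∀ f F e b x → degree f (set F e b) x + 𝟙 (F e ∧ (f e == x)) ≡ degree f F x + 𝟙 (b ∧ (f e == x))
  degree-set f F e b x = begin
      degree f (set F e b) x + 𝟙 (F e ∧ (f e == x))
    ≡⟨ sum-change-allFin e (λ e' → 𝟙 (set F e b e' ∧ (f e' == x))) (λ e' → 𝟙 (F e' ∧ (f e' == x)))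
         (λ e' e'≢e → cong (λ z → 𝟙 (z ∧ (f e' == x))) (set-other F b (λ e≡e' → e'≢e (sym e≡e')))) ⟩
      degree f F x + 𝟙 (set F e b e ∧ (f e == x))
    ≡⟨ cong (λ z → degree f F x + 𝟙 (z ∧ (f e == x))) (set-same F e b) ⟩
      degree f F x + 𝟙 (b ∧ (f e == x)) ∎
    where open ≡-Reasoning

  degree-add : ∀ f F e x → F e ≡ false → degree f (set F e true) x ≡ degree f F x + 𝟙 (f e == x)
  degree-add f F e x Fe≡false = begin
      degree f (set F e true) x                          ≡⟨ sym (+-identityʳ _) ⟩
      degree f (set F e true) x + 𝟙 (false ∧ (f e == x)) ≡⟨ cong (λ z → degree f (set F e true) x + 𝟙 (z ∧ (f e == x))) (sym Fe≡false) ⟩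
      degree f (set F e true) x + 𝟙 (F e ∧ (f e == x))   ≡⟨ degree-set f F e true x ⟩
      degree f F x + 𝟙 (f e == x)                        ∎
    where open ≡-Reasoning

  degree-remove : ∀ f F e x → F e ≡ true → degree f F x ≡ degree f (set F e false) x + 𝟙 (f e == x)
  degree-remove f F e x Fe≡true = begin
      degree f F x                                       ≡⟨ sym (+-identityʳ _) ⟩
      degree f F x + 𝟙 (false ∧ (f e == x))              ≡⟨ sym (degree-set f F e false x) ⟩
      degree f (set F e false) x + 𝟙 (F e ∧ (f e == x))  ≡⟨ cong (λ z → degree f (set F e false) x + 𝟙 (z ∧ (f e == x))) Fe≡true ⟩
      degree f (set F e false) x + 𝟙 (f e == x)          ∎
    where open ≡-Reasoning

  -- Shift F F' u w: passing from F to F' moves one unit of flow from u to w, i.e.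
  -- at every vertex x the out-degree grows by [x = u] − [x = w] more than the in-degree.
  record Shift (F F' : E → Bool) (u w : V) : Set where
    constructor shift
    field balance : ∀ x → outdeg F' x + indeg F x + 𝟙 (w == x) ≡ indeg F' x + outdeg F x + 𝟙 (u == x)
  open Shift

  shift-refl : ∀ F u → Shift F F u u
  shift-refl F u = shift λ x → cong (_+ 𝟙 (u == x)) (+-comm (outdeg F x) (indeg F x))

  shift-add-edge : ∀ F e → F e ≡ false → Shift F (set F e true) (tail G e) (head G e)
  shift-add-edge F e Fe≡false = shift balance-at
    where
    shuffle : ∀ o i t h → o + t + i + h ≡ i + h + o + t
    shuffle = solve-∀
    balance-at : ∀ x → outdeg (set F e true) x + indeg F x + 𝟙 (head G e == x)
                     ≡ indeg (set F e true) x + outdeg F x + 𝟙 (tail G e == x)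
    balance-at x rewrite degree-add (tail G) F e x Fe≡false | degree-add (head G) F e x Fe≡false =
      shuffle (outdeg F x) (indeg F x) (𝟙 (tail G e == x)) (𝟙 (head G e == x))

  shift-remove-edge : ∀ F e → F e ≡ true → Shift F (set F e false) (head G e) (tail G e)
  shift-remove-edge F e Fe≡true = shift balance-at
    where
    shuffle : ∀ o i t h → o + (i + h) + t ≡ i + (o + t) + h
    shuffle = solve-∀
    balance-at : ∀ x → outdeg (set F e false) x + indeg F x + 𝟙 (tail G e == x)
                     ≡ indeg (set F e false) x + outdeg F x + 𝟙 (head G e == x)
    balance-at x rewrite degree-remove (tail G) F e x Fe≡true | degree-remove (head G) F e x Fe≡true =
      shuffle (outdeg (set F e false) x) (indeg (set F e false) x) (𝟙 (tail G e == x)) (𝟙 (head G e == x))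

  shift-sym : ∀ {F F' u w} → Shift F F' u w → Shift F' F w u
  shift-sym {F} {F'} {u} {w} s = shift λ x → begin
      outdeg F x + indeg F' x + 𝟙 (u == x)  ≡⟨ cong (_+ 𝟙 (u == x)) (+-comm (outdeg F x) (indeg F' x)) ⟩
      indeg F' x + outdeg F x + 𝟙 (u == x)  ≡⟨ sym (balance s x) ⟩
      outdeg F' x + indeg F x + 𝟙 (w == x)  ≡⟨ cong (_+ 𝟙 (w == x)) (+-comm (outdeg F' x) (indeg F x)) ⟩
      indeg F x + outdeg F' x + 𝟙 (w == x)  ∎
    where open ≡-Reasoning

  shift-trans : ∀ {F F₁ F₂ u v w} → Shift F F₁ u v → Shift F₁ F₂ v w → Shift F F₂ u w
  shift-trans {F} {F₁} {F₂} {u} {v} {w} s₁ s₂ = shift λ x → +-cancelʳ-≡ (middle x) _ _ (begin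
      outdeg F₂ x + indeg F x + 𝟙 (w == x) + middle x
    ≡⟨ regroup (outdeg F₂ x) (indeg F x) (𝟙 (w == x)) (outdeg F₁ x) (indeg F₁ x) (𝟙 (v == x)) ⟩
      (outdeg F₂ x + indeg F₁ x + 𝟙 (w == x)) + (outdeg F₁ x + indeg F x + 𝟙 (v == x))
    ≡⟨ cong₂ _+_ (balance s₂ x) (balance s₁ x) ⟩
      (indeg F₂ x + outdeg F₁ x + 𝟙 (v == x)) + (indeg F₁ x + outdeg F x + 𝟙 (u == x))
    ≡⟨ regroup' (indeg F₂ x) (outdeg F₁ x) (𝟙 (v == x)) (indeg F₁ x) (outdeg F x) (𝟙 (u == x)) ⟩
      indeg F₂ x + outdeg F x + 𝟙 (u == x) + middle x ∎)
    where
    open ≡-Reasoning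
    middle : V → ℕ
    middle x = outdeg F₁ x + indeg F₁ x + 𝟙 (v == x)
    regroup : ∀ a b c o i d → a + b + c + (o + i + d) ≡ (a + i + c) + (o + b + d)
    regroup = solve-∀
    regroup' : ∀ a o d i b c → (a + o + d) + (i + b + c) ≡ a + b + c + (o + i + d)
    regroup' = solve-∀

  shift-trans˘ : ∀ {F F₁ F₂ u v w} → Shift F₁ F₂ u v → Shift F F₁ v w → Shift F F₂ u w
  shift-trans˘ {F} {F₁} {F₂} {u} {v} {w} s₂ s₁ = shift λ x → +-cancelʳ-≡ (middle x) _ _ (begin
      outdeg F₂ x + indeg F x + 𝟙 (w == x) + middle x
    ≡⟨ regroup (outdeg F₂ x) (indeg F x) (𝟙 (w == x)) (outdeg F₁ x) (indeg F₁ x) (𝟙 (v == x)) ⟩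
      (outdeg F₂ x + indeg F₁ x + 𝟙 (v == x)) + (outdeg F₁ x + indeg F x + 𝟙 (w == x))
    ≡⟨ cong₂ _+_ (balance s₂ x) (balance s₁ x) ⟩
      (indeg F₂ x + outdeg F₁ x + 𝟙 (u == x)) + (indeg F₁ x + outdeg F x + 𝟙 (v == x))
    ≡⟨ regroup' (indeg F₂ x) (outdeg F₁ x) (𝟙 (u == x)) (indeg F₁ x) (outdeg F x) (𝟙 (v == x)) ⟩
      indeg F₂ x + outdeg F x + 𝟙 (u == x) + middle x ∎)
    where
    open ≡-Reasoning
    middle : V → ℕ
    middle x = outdeg F₁ x + indeg F₁ x + 𝟙 (v == x)
    regroup : ∀ a b c o i d → a + b + c + (o + i + d) ≡ (a + i + d) + (o + b + c)
    regroup = solve-∀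
    regroup' : ∀ a o c i b d → (a + o + c) + (i + b + d) ≡ a + b + c + (o + i + d)
    regroup' = solve-∀

  -- The residual graph of a flow F inside the available edges S: an arc is an edge
  -- traversed forwards (true), allowed when the edge is available and unused, or
  -- backwards (false), allowed when the edge carries flow.
  Arc : Set
  Arc = E × Bool

  arc-src arc-dst : Arc → V
  arc-src (e , true)  = tail G e
  arc-src (e , false) = head G e
  arc-dst (e , true)  = head G e
  arc-dst (e , false) = tail G e

  residual : (E → Bool) → (E → Bool) → Arc → Bool
  residual S F (e , true)  = S e ∧ not (F e)
  residual S F (e , false) = F e

  all-arcs : List Arc
  all-arcs = map (λ e → e , true) (allFin (m G)) ++ map (λ e → e , false) (allFin (m G))

  ∈-all-arcs : ∀ a → a ∈ all-arcs
  ∈-all-arcs (e , true)  = ∈-++⁺ˡ (∈-map⁺ (λ e → e , true) (∈-allFin e))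
  ∈-all-arcs (e , false) = ∈-++⁺ʳ (map (λ e → e , true) (allFin (m G))) (∈-map⁺ (λ e → e , false) (∈-allFin e))

  module Residual (S F : E → Bool) = Routes arc-src arc-dst (residual S F)
  module Carried  (F : E → Bool)   = Routes (tail G) (head G) F

  augment : (E → Bool) → List Arc → E → Bool
  augment F []             = F
  augment F ((e , b) ∷ as) = augment (set F e b) as

  augment-uses : ∀ F as e → augment F as e ≡ true → F e ≡ true ⊎ (e , true) ∈ as
  augment-uses F []              e h = inj₁ h
  augment-uses F ((e' , b) ∷ as) e h with augment-uses (set F e' b) as e h
  ... | inj₂ e∈as = inj₂ (there e∈as)
  ... | inj₁ h' with e' ≟F e
  ...   | no _     = inj₁ h'
  ...   | yes refl with b
  ...     | true  = inj₂ (here refl)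
  ...     | false = ⊥-elim (true≢false (sym h'))

  augment-within : ∀ {S F u w as} → (∀ e → F e ≡ true → S e ≡ true) → Residual.Route S F u w as →
    ∀ e → augment F as e ≡ true → S e ≡ true
  augment-within {S} {F} {as = as} F⊆S p e h with augment-uses F as e h
  ... | inj₁ Fe = F⊆S e Fe
  ... | inj₂ e∈as with S e | Residual.admissible-on-route S F p e∈as
  ...   | true | _ = refl

  arcs-share-end : ∀ e b b' → arc-src (e , b) ≡ arc-src (e , b') ⊎ arc-src (e , b) ≡ arc-dst (e , b')
  arcs-share-end e true  true  = inj₁ refl
  arcs-share-end e true  false = inj₂ refl
  arcs-share-end e false true  = inj₂ refl
  arcs-share-end e false false = inj₁ refl

  simple-route-edges-distinct : ∀ {S F u w e b as} → Residual.Route S F u w ((e , b) ∷ as) →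
    Residual.Simple S F u ((e , b) ∷ as) → ∀ a → a ∈ as → ¬ proj₁ a ≡ e
  simple-route-edges-distinct {S} {F} (Routes.step (e , b) src≡ _ p) (u∉ ∷ _) (e' , b') a∈ refl
    with Residual.avoided-not-end S F p u∉ a∈ | arcs-share-end e b b'
  ... | src≢ , _ | inj₁ same = src≢ (trans (sym same) src≡)
  ... | _ , dst≢ | inj₂ same = dst≢ (trans (sym same) src≡)

  residual-set : ∀ S F e b a → ¬ proj₁ a ≡ e → residual S (set F e b) a ≡ residual S F a
  residual-set S F e b (e' , true)  e'≢e rewrite set-other F b (λ e≡e' → e'≢e (sym e≡e')) = refl
  residual-set S F e b (e' , false) e'≢e rewrite set-other F b (λ e≡e' → e'≢e (sym e≡e')) = refl

  residual-after-first : ∀ {S F u w e b as} (p : Residual.Route S F u w ((e , b) ∷ as)) →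
    Residual.Simple S F u ((e , b) ∷ as) → Residual.Route S (set F e b) (arc-dst (e , b)) w as
  residual-after-first {S} {F} {e = e} {b} p@(Routes.step _ _ _ rest) simple =
    weaken-route (λ a a∈ adm → trans (residual-set S F e b a (simple-route-edges-distinct p simple a a∈)) adm) rest

  augment-shift : ∀ {S F u w as} → Residual.Route S F u w as → Residual.Simple S F u as →
    Shift F (augment F as) u w
  augment-shift {F = F} {u} Routes.[] _ = shift-refl F u
  augment-shift {S} {F} p@(Routes.step (e , true) refl adm _) simple@(_ ∷ simple') =
    shift-trans (shift-add-edge F e (unused (S e) (F e) adm)) (augment-shift (residual-after-first p simple) simple')
    where
    unused : ∀ s f → s ∧ not f ≡ true → f ≡ false
    unused true false _ = refl
  augment-shift {S} {F} p@(Routes.step (e , false) refl adm _) simple@(_ ∷ simple') =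
    shift-trans (shift-remove-edge F e adm) (augment-shift (residual-after-first p simple) simple')

  remove : (E → Bool) → List E → E → Bool
  remove F []       = F
  remove F (e ∷ es) = remove (set F e false) es

  remove-⊆ : ∀ F es e → remove F es e ≡ true → F e ≡ true
  remove-⊆ F []        e h = h
  remove-⊆ F (e' ∷ es) e h with e' ≟F e
  ... | no e'≢e = trans (sym (set-other F false e'≢e)) (remove-⊆ (set F e' false) es e h)
  ... | yes refl = ⊥-elim (true≢false (trans (sym (remove-⊆ (set F e false) es e h)) (set-same F e false)))

  remove-removes : ∀ F es e → e ∈ es → remove F es e ≡ false
  remove-removes F (e ∷ es) e (here refl) with remove (set F e false) es e in eq
  ... | false = refl
  ... | true  = ⊥-elim (true≢false (trans (sym (remove-⊆ (set F e false) es e eq)) (set-same F e false)))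
  remove-removes F (e' ∷ es) e (there e∈es) = remove-removes (set F e' false) es e e∈es

  remove-shift : ∀ {F u w es} → Carried.Route F u w es → Carried.Simple F u es → Shift (remove F es) F u w
  remove-shift {F} {u} Routes.[] _ = shift-refl F u
  remove-shift {F} {w = w} {e ∷ es} (Routes.step e refl Fe p) (u∉ ∷ simple) =
    shift-trans˘ (shift-sym (shift-remove-edge F e Fe)) (remove-shift rest simple)
    where
    rest : Carried.Route (set F e false) (head G e) w es
    rest = weaken-route (λ e' e'∈ Fe' → trans (set-other F false
             (λ e≡e' → proj₁ (Carried.avoided-not-end F p u∉ e'∈) (cong (tail G) (sym e≡e')))) Fe') p

  IsFlow : V → V → (E → Bool) → ℕ → Set
  IsFlow r t F j = ∀ x → ¬ x ≡ t → outdeg F x ≡ indeg F x + (if r == x then j else 0)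

  empty-flow : ∀ r t → IsFlow r t (λ _ → false) 0
  empty-flow r t x _ = begin
      outdeg (λ _ → false) x         ≡⟨ no-edges (tail G) ⟩
      0                              ≡⟨ sym (no-edges (head G)) ⟩
      indeg (λ _ → false) x          ≡⟨ sym (+-identityʳ _) ⟩
      indeg (λ _ → false) x + 0      ≡⟨ cong (indeg (λ _ → false) x +_) (sym (if-eta (r == x))) ⟩
      indeg (λ _ → false) x + (if r == x then 0 else 0) ∎
    where
    open ≡-Reasoning
    no-edges : ∀ f → degree f (λ _ → false) x ≡ 0
    no-edges f = count-zero (λ e → false ∧ (f e == x)) (λ _ → refl)

  flow-shift : ∀ {r t F F' j} → IsFlow r t F j → Shift F F' r t → IsFlow r t F' (suc j)
  flow-shift {r} {t} {F} {F'} {j} flow s x x≢t =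
    value-up (r == x) (trans (cong (outdeg F' x + indeg F x +_) (cong 𝟙 (sym (==-false (λ t≡x → x≢t (sym t≡x))))))
                             (balance s x))
                      (flow x x≢t)
    where
    value-up : ∀ b {o i o' i'} → o' + i + 0 ≡ i' + o + 𝟙 b → o ≡ i + (if b then j else 0) →
               o' ≡ i' + (if b then suc j else 0)
    value-up false {o} {i} {o'} {i'} bal refl = +-cancelʳ-≡ i _ _ (begin
        o' + i             ≡⟨ sym (+-identityʳ _) ⟩
        o' + i + 0         ≡⟨ bal ⟩
        i' + (i + 0) + 0   ≡⟨ regroup i' i ⟩
        i' + 0 + i         ∎)
      where
      open ≡-Reasoning
      regroup : ∀ a b → a + (b + 0) + 0 ≡ a + 0 + b
      regroup = solve-∀
    value-up true {o} {i} {o'} {i'} bal refl = +-cancelʳ-≡ i _ _ (begin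
        o' + i             ≡⟨ sym (+-identityʳ _) ⟩
        o' + i + 0         ≡⟨ bal ⟩
        i' + (i + j) + 1   ≡⟨ regroup i' i j ⟩
        i' + suc j + i     ∎)
      where
      open ≡-Reasoning
      regroup : ∀ a b c → a + (b + c) + 1 ≡ a + suc c + b
      regroup = solve-∀

  flow-unshift : ∀ {r t F F' j} → IsFlow r t F (suc j) → Shift F' F r t → IsFlow r t F' j
  flow-unshift {r} {t} {F} {F'} {j} flow s x x≢t =
    value-down (r == x) (trans (cong (outdeg F x + indeg F' x +_) (cong 𝟙 (sym (==-false (λ t≡x → x≢t (sym t≡x))))))
                               (balance s x))
                        (flow x x≢t)
    where
    value-down : ∀ b {o i o' i'} → o + i' + 0 ≡ i + o' + 𝟙 b → o ≡ i + (if b then suc j else 0) →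
                 o' ≡ i' + (if b then j else 0)
    value-down false {o} {i} {o'} {i'} bal refl = +-cancelˡ-≡ i _ _ (begin
        i + o'             ≡⟨ regroup i o' ⟩
        i + o' + 0         ≡⟨ sym bal ⟩
        i + 0 + i' + 0     ≡⟨ regroup' i i' ⟩
        i + (i' + 0)       ∎)
      where
      open ≡-Reasoning
      regroup : ∀ a b → a + b ≡ a + b + 0
      regroup = solve-∀
      regroup' : ∀ a b → a + 0 + b + 0 ≡ a + (b + 0)
      regroup' = solve-∀
    value-down true {o} {i} {o'} {i'} bal refl = +-cancelˡ-≡ (suc i) _ _ (begin
        suc i + o'          ≡⟨ regroup i o' ⟩
        i + o' + 1          ≡⟨ sym bal ⟩
        i + suc j + i' + 0  ≡⟨ regroup' i j i' ⟩
        suc i + (i' + j)    ∎)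
      where
      open ≡-Reasoning
      regroup : ∀ a b → suc a + b ≡ a + b + 1
      regroup = solve-∀
      regroup' : ∀ a c b → a + suc c + b + 0 ≡ suc a + (b + c)
      regroup' = solve-∀

  leaving entering : (E → Bool) → (V → Bool) → E → Bool
  leaving  F X e = (F e ∧ X (tail G e)) ∧ not (X (head G e))
  entering F X e = (F e ∧ X (head G e)) ∧ not (X (tail G e))

  degree-sum : ∀ (f : E → V) (F : E → Bool) (X : V → Bool) →
    sumOver (λ x → if X x then degree f F x else 0) (allFin (n G)) ≡ count (λ e → F e ∧ X (f e))
  degree-sum f F X = begin
      sumOver (λ x → if X x then degree f F x else 0) (allFin (n G))
    ≡⟨ sumOver-cong (allFin (n G)) (λ x → sumOver-if (X x) (λ e → 𝟙 (F e ∧ (f e == x))) (allFin (m G))) ⟩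
      sumOver (λ x → sumOver (λ e → term e x) (allFin (m G))) (allFin (n G))
    ≡⟨ sumOver-swap (λ x e → term e x) (allFin (n G)) (allFin (m G)) ⟩
      sumOver (λ e → sumOver (term e) (allFin (n G))) (allFin (m G))
    ≡⟨ sumOver-cong (allFin (m G)) edge-contribution ⟩
      count (λ e → F e ∧ X (f e)) ∎
    where
    open ≡-Reasoning
    term : E → V → ℕ
    term e x = if X x then 𝟙 (F e ∧ (f e == x)) else 0
    as-point : ∀ a b c → (if a then 𝟙 (b ∧ c) else 0) ≡ (if c then (if a then 𝟙 b else 0) else 0)
    as-point true  true  true  = refl
    as-point true  false true  = refl
    as-point true  false false = refl
    as-point true  true  false = refl
    as-point false _     true  = refl
    as-point false _     false = refl
    at-point : ∀ a b → (if a then 𝟙 b else 0) ≡ 𝟙 (b ∧ a)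
    at-point true  true  = refl
    at-point true  false = refl
    at-point false true  = refl
    at-point false false = refl
    edge-contribution : ∀ e → sumOver (term e) (allFin (n G)) ≡ 𝟙 (F e ∧ X (f e))
    edge-contribution e = begin
        sumOver (term e) (allFin (n G))
      ≡⟨ sumOver-cong (allFin (n G)) (λ x → as-point (X x) (F e) (f e == x)) ⟩
        sumOver (λ x → if f e == x then (if X x then 𝟙 (F e) else 0) else 0) (allFin (n G))
      ≡⟨ sum-point-allFin (f e) (λ x → if X x then 𝟙 (F e) else 0) ⟩
        (if X (f e) then 𝟙 (F e) else 0)
      ≡⟨ at-point (X (f e)) (F e) ⟩
        𝟙 (F e ∧ X (f e)) ∎

  flow-across-cut : ∀ {r t F j} (X : V → Bool) → IsFlow r t F j → X r ≡ true → X t ≡ false →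
    count (leaving F X) ≡ count (entering F X) + j
  flow-across-cut {r} {t} {F} {j} X flow Xr Xt = +-cancelˡ-≡ inside _ _ (begin
      inside + count (leaving F X)
    ≡⟨ sym (count-split (λ e → F e ∧ X (tail G e)) (λ e → X (head G e))) ⟩
      count (λ e → F e ∧ X (tail G e))
    ≡⟨ sym (degree-sum (tail G) F X) ⟩
      sumOver (λ x → if X x then outdeg F x else 0) (allFin (n G))
    ≡⟨ sumOver-cong (allFin (n G)) conservation ⟩
      sumOver (λ x → (if X x then indeg F x else 0) + (if r == x then (if X x then j else 0) else 0)) (allFin (n G))
    ≡⟨ sumOver-+ _ _ (allFin (n G)) ⟩
      sumOver (λ x → if X x then indeg F x else 0) (allFin (n G))
        + sumOver (λ x → if r == x then (if X x then j else 0) else 0) (allFin (n G))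
    ≡⟨ cong₂ _+_ (degree-sum (head G) F X) (sum-point-allFin r (λ x → if X x then j else 0)) ⟩
      count (λ e → F e ∧ X (head G e)) + (if X r then j else 0)
    ≡⟨ cong₂ _+_ (count-split (λ e → F e ∧ X (head G e)) (λ e → X (tail G e))) (cong (λ z → if z then j else 0) Xr) ⟩
      inside' + count (entering F X) + j
    ≡⟨ cong (λ z → z + count (entering F X) + j) (count-cong (λ e → swap-last (F e) (X (head G e)) (X (tail G e)))) ⟩
      inside + count (entering F X) + j
    ≡⟨ +-assoc inside _ j ⟩
      inside + (count (entering F X) + j) ∎)
    where
    open ≡-Reasoning
    inside inside' : ℕ
    inside  = count (λ e → (F e ∧ X (tail G e)) ∧ X (head G e))
    inside' = count (λ e → (F e ∧ X (head G e)) ∧ X (tail G e))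
    swap-last : ∀ a b c → (a ∧ b) ∧ c ≡ (a ∧ c) ∧ b
    swap-last a b c = trans (∧-assoc a b c) (trans (cong (a ∧_) (∧-comm b c)) (sym (∧-assoc a c b)))
    conservation : ∀ x → (if X x then outdeg F x else 0)
                       ≡ (if X x then indeg F x else 0) + (if r == x then (if X x then j else 0) else 0)
    conservation x with X x in Xx
    ... | false = sym (if-eta (r == x))
    ... | true  = flow x (λ x≡t → true≢false (trans (sym Xx) (trans (cong X x≡t) Xt)))

  -- A set X containing r but not t that no residual arc leaves is a cut of size at
  -- most the flow value: every available edge leaving X carries flow, and no flow
  -- edge enters X.
  closed-set-cut : ∀ {S F r t j} (X : V → Bool) → IsFlow r t F j → X r ≡ true → X t ≡ false →
    (∀ a → residual S F a ≡ true → X (arc-src a) ≡ true → X (arc-dst a) ≡ true) →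
    count (leaving S X) ≤ j
  closed-set-cut {S} {F} {j = j} X flow Xr Xt closed = begin
      count (leaving S X)       ≤⟨ count-mono saturated ⟩
      count (leaving F X)       ≡⟨ flow-across-cut X flow Xr Xt ⟩
      count (entering F X) + j  ≡⟨ cong (_+ j) (count-zero (entering F X) nothing-enters) ⟩
      j                         ∎
    where
    open ≤-Reasoning
    saturated : ∀ e → leaving S X e ≡ true → leaving F X e ≡ true
    saturated e h with S e in Se | F e in Fe | X (tail G e) in Xtail | X (head G e) in Xhead
    ... | true  | true  | true  | false = refl
    ... | true  | false | true  | false =
      ⊥-elim (true≢false (trans (sym (closed (e , true) (cong₂ _∧_ Se (cong not Fe)) Xtail)) Xhead))
    ... | true  | _     | false | _     = ⊥-elim (true≢false (sym h))
    ... | true  | _     | true  | true  = ⊥-elim (true≢false (sym h))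
    ... | false | _     | _     | _     = ⊥-elim (true≢false (sym h))
    nothing-enters : ∀ e → entering F X e ≡ false
    nothing-enters e with F e in Fe | X (head G e) in Xhead | X (tail G e) in Xtail
    ... | true  | true  | false = ⊥-elim (true≢false (trans (sym (closed (e , false) Fe Xhead)) Xtail))
    ... | true  | true  | true  = refl
    ... | true  | false | _     = refl
    ... | false | _     | _     = refl

  -- Augmenting paths, the hard half of max-flow/min-cut for unit capacities: within
  -- the available edges S there is an r,t-flow of value j, or a set containing r but
  -- not t that fewer than j available edges leave.
  flow-or-cut : (S : E → Bool) (r t : V) (j : ℕ) →
    (Σ (E → Bool) λ F → (∀ e → F e ≡ true → S e ≡ true) × IsFlow r t F j) ⊎
    (Σ (V → Bool) λ X → X r ≡ true × X t ≡ false × count (leaving S X) < j)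
  flow-or-cut S r t zero = inj₁ ((λ _ → false) , (λ _ ()) , empty-flow r t)
  flow-or-cut S r t (suc j) with flow-or-cut S r t j
  ... | inj₂ (X , Xr , Xt , small) = inj₂ (X , Xr , Xt , m≤n⇒m≤1+n small)
  ... | inj₁ (F , F⊆S , flow) with Residual.Reachability.route-or-closed-set S F all-arcs ∈-all-arcs r t
  ...   | inj₁ (_ , p) =
          let (as , p' , simple , _) = Residual.shortcut S F p
          in inj₁ (augment F as , augment-within F⊆S p' , flow-shift flow (augment-shift p' simple))
  ...   | inj₂ (X , Xr , Xt , closed) = inj₂ (X , Xr , Xt , s≤s (closed-set-cut X flow Xr Xt closed))

  -- A flow of positive value from r to t contains an r,t-route: otherwise the
  -- vertices reachable from r would form a set that no flow edge leaves.
  positive-flow-route : ∀ {r t j} F → IsFlow r t F (suc j) → Σ (List E) λ es → Carried.Route F r t es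
  positive-flow-route {r} {t} {j} F flow with Carried.Reachability.route-or-closed-set F (allFin (m G)) ∈-allFin r t
  ... | inj₁ route = route
  ... | inj₂ (X , Xr , Xt , closed) = ⊥-elim (0≢1+n (begin
      0                              ≡⟨ sym (count-zero (leaving F X) nothing-leaves) ⟩
      count (leaving F X)            ≡⟨ flow-across-cut X flow Xr Xt ⟩
      count (entering F X) + suc j   ≡⟨ +-suc _ j ⟩
      suc (count (entering F X) + j) ∎))
    where
    open ≡-Reasoning
    nothing-leaves : ∀ e → leaving F X e ≡ false
    nothing-leaves e with F e in Fe | X (tail G e) in Xtail | X (head G e) in Xhead
    ... | true  | true  | false = ⊥-elim (true≢false (trans (sym (closed e Fe Xtail)) Xhead))
    ... | true  | true  | true  = refl
    ... | true  | false | _     = refl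
    ... | false | _     | _     = refl

  DisjointRoutes : (E → Bool) → V → V → (j : ℕ) → (Fin j → List E) → Set
  DisjointRoutes F r t j P = (∀ i → Carried.Route F r t (P i) × Carried.Simple F r (P i)) ×
    (∀ i i' → ¬ i ≡ i' → ∀ e → e ∈ P i → e ∈ P i' → ⊥)

  -- Flow decomposition: an r,t-flow of value j splits off j edge-disjoint simple
  -- r,t-routes, by repeatedly removing a simple route and lowering the value.
  decompose : ∀ r t j F → IsFlow r t F j → Σ (Fin j → List E) (DisjointRoutes F r t j)
  decompose r t zero    F flow = (λ ()) , (λ ()) , (λ ())
  decompose r t (suc j) F flow = P , routes , disjoint
    where
    found = Carried.shortcut F (proj₂ (positive-flow-route F flow))
    π = proj₁ found
    π-route = proj₁ (proj₂ found)
    π-simple = proj₁ (proj₂ (proj₂ found))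
    rest = decompose r t j (remove F π) (flow-unshift flow (remove-shift π-route π-simple))
    P : Fin (suc j) → List E
    P zero    = π
    P (suc i) = proj₁ rest i
    rest-route : ∀ i → Carried.Route (remove F π) r t (proj₁ rest i)
    rest-route i = proj₁ (proj₁ (proj₂ rest) i)
    routes : ∀ i → Carried.Route F r t (P i) × Carried.Simple F r (P i)
    routes zero    = π-route , π-simple
    routes (suc i) = weaken-route (λ e _ → remove-⊆ F π e) (rest-route i) , proj₂ (proj₁ (proj₂ rest) i)
    -- the edges of π are gone from remove F π, so no later route uses them
    avoids-π : ∀ i e → e ∈ π → e ∈ proj₁ rest i → ⊥
    avoids-π i e e∈π e∈rest =
      true≢false (trans (sym (Carried.admissible-on-route (remove F π) (rest-route i) e∈rest)) (remove-removes F π e e∈π))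
    disjoint : ∀ i i' → ¬ i ≡ i' → ∀ e → e ∈ P i → e ∈ P i' → ⊥
    disjoint zero    zero     i≢i' = ⊥-elim (i≢i' refl)
    disjoint zero    (suc i') _ e e∈π e∈rest = avoids-π i' e e∈π e∈rest
    disjoint (suc i) zero     _ e e∈rest e∈π = avoids-π i e e∈π e∈rest
    disjoint (suc i) (suc i') i≢i' = proj₂ (proj₂ rest) i i' (λ i≡i' → i≢i' (cong suc i≡i'))

module Menger (G : Digraph) where
  open Flows G

  cut : EdgeSet G → (V → Bool) → ℕ
  cut H X = count (leaving (lookup H) X)

  route-walk : ∀ {H : EdgeSet G} {F : E → Bool} {u w es} → (∀ e → F e ≡ true → lookup H e ≡ true) →
    Carried.Route F u w es → Walk G H u w es
  route-walk F⊆H Routes.[]                 = []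
  route-walk {H} F⊆H (Routes.step e s Fe p) = _∷_ e {s} {lookup⇒[]= e H (F⊆H e Fe)} (route-walk F⊆H p)

  crossing-edge : ∀ {H : EdgeSet G} {u w es} (X : V → Bool) → Walk G H u w es → X u ≡ true → X w ≡ false →
    Σ E λ e → e ∈ es × leaving (lookup H) X e ≡ true
  crossing-edge X [] Xu Xw = ⊥-elim (true≢false (trans (sym Xu) Xw))
  crossing-edge X (_∷_ e {refl} {e∈H} p) Xu Xw with X (head G e) in Xhead
  ... | false = e , here refl , cong₂ _∧_ (cong₂ _∧_ ([]=⇒lookup e∈H) Xu) (cong not Xhead)
  ... | true with crossing-edge X p Xhead Xw
  ...   | e' , e'∈es , leaves = e' , there e'∈es , leaves

  -- Weak duality: j edge-disjoint r,w-paths cross every cut separating r from w in j distinct edges.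
  weak-duality : ∀ {H : EdgeSet G} {r w j} (X : V → Bool) → HasDisjointPaths G H r w j →
    X r ≡ true → X w ≡ false → j ≤ cut H X
  weak-duality {H} {j = j} X (P , paths , _ , disjoint) Xr Xw = injection-≤-count crossing crossing-injective _ crossing-leaves
    where
    crossing-of : ∀ i → Σ E λ e → e ∈ P i × leaving (lookup H) X e ≡ true
    crossing-of i = crossing-edge X (proj₁ (paths i)) Xr Xw
    crossing : Fin j → E
    crossing i = proj₁ (crossing-of i)
    crossing-leaves : ∀ i → leaving (lookup H) X (crossing i) ≡ true
    crossing-leaves i = proj₂ (proj₂ (crossing-of i))
    crossing-injective : ∀ {a b} → crossing a ≡ crossing b → a ≡ b
    crossing-injective {a} {b} same with a ≟F b
    ... | yes a≡b = a≡b
    ... | no a≢b  = ⊥-elim (disjoint a b a≢b (crossing a) (proj₁ (proj₂ (crossing-of a)))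
                              (subst (_∈ P b) (sym same) (proj₁ (proj₂ (crossing-of b)))))

  menger : ∀ (H : EdgeSet G) r t j → ¬ r ≡ t →
    HasDisjointPaths G H r t j ⊎ (Σ (V → Bool) λ X → X r ≡ true × X t ≡ false × cut H X < j)
  menger H r t j r≢t with flow-or-cut (lookup H) r t j
  ... | inj₂ small-cut = inj₂ small-cut
  ... | inj₁ (F , F⊆H , flow) = inj₁ (P , paths , P-injective , disjoint)
    where
    decomposition = decompose r t j F flow
    P = proj₁ decomposition
    routes = proj₁ (proj₂ decomposition)
    disjoint = proj₂ (proj₂ decomposition)
    paths : ∀ i → IsPath G H r t (P i)
    paths i = route-walk F⊆H (proj₁ (routes i)) , proj₂ (routes i)
    -- r ≠ t, so every route has a first edge, which no other route shares
    first-edge : ∀ i → Σ E λ e → e ∈ P i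
    first-edge i with P i | proj₁ (routes i)
    ... | []    | Routes.[]         = ⊥-elim (r≢t refl)
    ... | e ∷ _ | Routes.step _ _ _ _ = e , here refl
    P-injective : ∀ {a b} → P a ≡ P b → a ≡ b
    P-injective {a} {b} same with a ≟F b
    ... | yes a≡b = a≡b
    ... | no a≢b  = let (e , e∈Pa) = first-edge a in ⊥-elim (disjoint a b a≢b e e∈Pa (subst (e ∈_) same e∈Pa))

module DeleteEdge (G : Digraph) where
  open Flows G
  open Menger G

  root-path-empty : ∀ {H : EdgeSet G} {r es} → IsPath G H r r es → es ≡ []
  root-path-empty {es = []}     _              = refl
  root-path-empty {es = e ∷ es} (p , r∉ ∷ _) = ⊥-elim (All¬⇒¬Any r∉ (end-visited p))
    where
    end-visited : ∀ {H : EdgeSet G} {u w e es} → Walk G H u w (e ∷ es) → w ∈ map (head G) (e ∷ es)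
    end-visited (_ ∷ [])           = here refl
    end-visited (_ ∷ p@(_ ∷ _))    = there (end-visited p)

  no-two-root-paths : ∀ {H : EdgeSet G} {r j} → ¬ HasDisjointPaths G H r r (suc (suc j))
  no-two-root-paths (P , paths , P-injective , _) with
    P-injective {zero} {suc zero} (trans (root-path-empty (paths zero)) (sym (root-path-empty (paths (suc zero)))))
  ... | ()

  -- The r,r-paths (all empty) exist in every subgraph.
  root-paths-anywhere : ∀ {H H' : EdgeSet G} {r j} → HasDisjointPaths G H r r j → HasDisjointPaths G H' r r j
  root-paths-anywhere {H' = H'} {r} (P , paths , P-injective , disjoint) =
    P , (λ i → subst (IsPath G H' r r) (sym (root-path-empty (paths i))) ([] , [] ∷ [])) , P-injective , disjoint

  edge-into : ∀ {H : EdgeSet G} {r v j} → HasDisjointPaths G H r v (suc j) → ¬ v ≡ r →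
    Σ E λ e → e ∈ₛ H × head G e ≡ v
  edge-into (P , paths , _) v≢r with P zero | proj₁ (paths zero)
  ... | []    | []          = ⊥-elim (v≢r refl)
  ... | _ ∷ _ | p@(_ ∷ _)   = last-edge p
    where
    last-edge : ∀ {H : EdgeSet G} {u w e es} → Walk G H u w (e ∷ es) → Σ E λ e' → e' ∈ₛ H × head G e' ≡ w
    last-edge (_∷_ e {_} {e∈H} [])  = e , e∈H , refl
    last-edge (_ ∷ p@(_ ∷ _))       = last-edge p

  leaving-delete : ∀ (H : EdgeSet G) e₀ X e → ¬ e ≡ e₀ → leaving (lookup H) X e ≡ true → leaving (lookup (H - e₀)) X e ≡ true
  leaving-delete H e₀ X e e≢e₀ leaves with lookup H e in He | lookup (H - e₀) e in He'
  ... | true  | true  = leaves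
  ... | true  | false = ⊥-elim (true≢false (trans (sym ([]=⇒lookup (x∈p∧x≢y⇒x∈p-y (lookup⇒[]= e H He) e≢e₀))) He'))

  cut-delete : ∀ H e₀ X → cut H X ≤ cut (H - e₀) X + 1
  cut-delete H e₀ X = count-except-one e₀ (leaving-delete H e₀ X)

  cut-delete-inside : ∀ H e₀ X → X (head G e₀) ≡ true → cut H X ≤ cut (H - e₀) X
  cut-delete-inside H e₀ X inside = count-mono still-leaving
    where
    still-leaving : ∀ e → leaving (lookup H) X e ≡ true → leaving (lookup (H - e₀)) X e ≡ true
    still-leaving e leaves with e ≟F e₀
    ... | no e≢e₀ = leaving-delete H e₀ X e e≢e₀ leaves
    ... | yes refl with lookup H e | X (tail G e)
    ...   | true | true rewrite inside = ⊥-elim (true≢false (sym leaves))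

  -- For a terminal t
  -- left with fewer than K paths, Menger gives a cut X of H - e₀ with fewer than K
  -- edges.  If v ∈ X the cut is also a cut of H, contradicting feasibility; if v ∉ X,
  -- H has at most K edges leaving X, too few for the K + 1 paths to v.
  delete-edge-into-rich-vertex : ∀ {r T K H v e₀} → Feasible G r T K H → HasDisjointPaths G H r v (suc K) →
    e₀ ∈ₛ H → head G e₀ ≡ v → Feasible G r T K (H - e₀)
  delete-edge-into-rich-vertex {r} {T} {K} {H} {v} {e₀} feasible rich _ e₀↦v t t∈T with t ≟F r
  ... | yes refl = root-paths-anywhere (feasible t t∈T)
  ... | no t≢r with menger (H - e₀) r t K (λ r≡t → t≢r (sym r≡t))
  ...   | inj₁ paths = paths
  ...   | inj₂ (X , Xr , Xt , small) with X v in Xv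
  ...     | true  = ⊥-elim (<⇒≱ small (≤-trans (weak-duality X (feasible t t∈T) Xr Xt)
                                           (cut-delete-inside H e₀ X (trans (cong X e₀↦v) Xv))))
  ...     | false = ⊥-elim (<⇒≱ (s≤s small) (≤-trans (weak-duality X rich Xr Xv)
                                                (≤-trans (cut-delete H e₀ X) (≤-reflexive (+-comm _ 1)))))

-- v = r is impossible as k + 1 ≥ 2; otherwise deleting an edge e₀ of H entering v
-- keeps H feasible, contradicting minimality.
lemma3 : (G : Digraph) (r : Vertex G) (T : Subset (n G)) (k : ℕ) → k ≥ 1 →
         (H : EdgeSet G) → Minimal G r T k H →
         (v : Vertex G) → InV G H r T v →
         ¬ HasDisjointPaths G H r v (suc k)
lemma3 G r T (suc k) (s≤s z≤n) H (feasible , minimal) v _ rich = v-not-rich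
  where
  open DeleteEdge G
  v-not-rich : ⊥
  v-not-rich with v ≟F r
  ... | yes refl = no-two-root-paths rich
  ... | no v≢r   =
    let (e₀ , e₀∈H , e₀↦v) = edge-into rich v≢r
    in minimal e₀ e₀∈H (delete-edge-into-rich-vertex feasible rich e₀∈H e₀↦v)
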